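{- For all integers $l,m,n\ge 0$, the following identity holds in $\mathbb{Z}[[q]]$: $$\frac{1}{(q)_\infty}=\chi_{n\ge1,\,m\ge1}\sum_{j=0}^{m-1}\frac{q^{nj}}{(q)_{n-1}(q)_j}+\sum_{k=0}^{\infty}\frac{q^{(k+n)((l+1)k+m)}}{(q)_{k+n}(q)_{(l+1)k+m}}+\sum_{i=1}^{l}\sum_{k=0}^{\infty}\frac{q^{(k+n+1)((l+1)k+m+i)}}{(q)_{k+n}(q)_{(l+1)k+m+i}},$$ where $\chi_{n\ge1,\,m\ge1}$ equals $1$ if $n\ge1$ and $m\ge1$, and $0$ otherwise.
   Context: $(q)_k=\prod_{i=1}^k(1-q^i)$ for $k\in\mathbb{Z}_{\ge0}\cup\{\infty\}$, with $(q)_0=1$. An empty sum (e.g. $\sum_{i=1}^{0}$) is $0$. -}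

module Defs where

open import Data.Nat as ℕ using (ℕ; zero; suc; _≡ᵇ_)
open import Data.Integer using (ℤ; +_; -_; _+_; _*_; _-_; 0ℤ; 1ℤ)
open import Data.Bool using (if_then_else_)
open import Data.List using (List; []; _∷_; upTo; map; zipWith; foldr; head)
open import Data.Maybe using (fromMaybe)
open import Relation.Binary.PropositionalEquality using (_≡_)

PS : Set
PS = ℕ → ℤ

infix 4 _≈_
_≈_ : PS → PS → Set
f ≈ g = ∀ N → f N ≡ g N

0ps : PS
0ps _ = 0ℤ

1ps : PS
1ps zero    = 1ℤ
1ps (suc _) = 0ℤ

qpow : ℕ → PS
qpow e N = if N ≡ᵇ e then 1ℤ else 0ℤ

infixl 6 _⊕_ _⊖_
infixl 7 _⊛_ _⊘_

_⊕_ : PS → PS → PS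
(f ⊕ g) N = f N + g N

_⊖_ : PS → PS → PS
(f ⊖ g) N = f N - g N

sumℤ : List ℤ → ℤ
sumℤ = foldr _+_ 0ℤ

_⊛_ : PS → PS → PS
(f ⊛ g) N = sumℤ (map (λ i → f i * g (N ℕ.∸ i)) (upTo (suc N)))

-- Multiplicative inverse of a series f with constant term 1:
-- c_0 = 1,  c_N = - Σ_{i=1}^{N} f_i c_{N-i}.
-- invRev f N is the list [c_N, c_{N-1}, ..., c_0].
invRev : PS → ℕ → List ℤ
invRev f zero    = 1ℤ ∷ []
invRev f (suc N) =
  let cs = invRev f N in
  (- sumℤ (zipWith _*_ (map (λ i → f (suc i)) (upTo (suc N))) cs)) ∷ cs

inv : PS → PS
inv f N = fromMaybe 0ℤ (head (invRev f N))

-- division by a series with constant term 1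
_⊘_ : PS → PS → PS
f ⊘ g = f ⊛ inv g

poch : ℕ → PS
poch zero    = 1ps
poch (suc k) = poch k ⊛ (1ps ⊖ qpow (suc k))

-- (q)_∞: its coefficient of q^N agrees with that of (q)_N
-- (factors 1 - q^i with i > N do not affect coefficients up to q^N).
pochInf : PS
pochInf N = poch N N

sumPS : ℕ → (ℕ → PS) → PS
sumPS zero    F = 0ps
sumPS (suc n) F = sumPS n F ⊕ F n

sumPS1 : ℕ → (ℕ → PS) → PS
sumPS1 n F = sumPS n (λ i → F (suc i))

-- Infinite sum Σ_{k=0}^{∞} F k for a family whose k-th term has q-adic
-- valuation ≥ k (so the sum converges q-adically); the coefficient of q^N
-- only receives contributions from k ≤ N.
sumInf : (ℕ → PS) → PS
sumInf F N = sumPS (suc N) F N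

case-χ : ℕ → ℕ → PS
case-χ (suc n') (suc m') =
  sumPS (suc m') (λ j → qpow (suc n' ℕ.* j) ⊘ (poch n' ⊛ poch j))
case-χ _ _ = 0ps

module Submission where

-- Put L(a, b) = case-χ a b, so that L(0, b) = 0 and L(a+1, b) = Σ_{j<b} q^{(a+1)j} / ((q)_a (q)_j); the
-- χ-term of the theorem is L(n, m).  Besides the row recursion L(a+1, b+1) = L(a+1, b) + q^{(a+1)b} /
-- ((q)_a (q)_b) that defines it, L satisfies the diagonal recursion L(a+1, b+1) = L(a, b) + q^{ab} /
-- ((q)_a (q)_b); by induction on b this reduces to a four-term identity that follows from
-- 1/(q)_{k-1} = (1 - q^k)/(q)_k.  One diagonal step followed by l row steps carries (k+n, (l+1)k+m) to
-- (k+1+n, (l+1)(k+1)+m) and adds exactly the k-th summands of the two series, so L(n, m) plus both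
-- series truncated after k = N is L(N+1+n, (l+1)(N+1)+m).  In degree N only its term 1/(q)_{N+n}
-- contributes, and that agrees with 1/(q)_∞ up to degree N + n.

open import Defs
open import Data.Nat using (ℕ; zero; suc; _+_; _*_; _∸_; _≤_; _<_; s≤s; z≤n)
import Data.Nat.Properties as ℕₚ
open import Data.Nat.Tactic.RingSolver using (solve-∀)
open import Data.Integer using (ℤ; 0ℤ; 1ℤ)
  renaming (_+_ to _+ᶻ_; _*_ to _*ᶻ_; -_ to -ᶻ_; _-_ to _-ᶻ_)
import Data.Integer.Properties as ℤₚ
open import Data.Integer.Solver using (module +-*-Solver)
open import Data.List using (_∷_; applyUpTo; zipWith; head)
open import Data.List.Properties using (map-upTo; map-cong-local)
open import Data.List.Relation.Unary.All.Properties using (applyUpTo⁺₁)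
open import Data.Maybe using (Maybe; just; nothing; fromMaybe)
open import Data.Product using (_,_)
open import Data.Sum using (inj₁; inj₂)
open import Function using (_∘_)
open import Relation.Nullary using (yes; no)
open import Relation.Binary.PropositionalEquality
  using (_≡_; refl; cong; cong₂; cong-app; sym; trans; module ≡-Reasoning)
import Relation.Binary.Reasoning.Setoid
open import Algebra.Bundles using (CommutativeRing)
import Algebra.Construct.Pointwise as Pointwise
open import Algebra.Solver.Ring.AlmostCommutativeRing
  using (fromCommutativeRing; _-Raw-AlmostCommutative⟶_)
import Algebra.Solver.Ring

⊛-zero : ∀ f g → (f ⊛ g) 0 ≡ f 0 *ᶻ g 0
⊛-zero f g = ℤₚ.+-identityʳ _

⊛-suc : ∀ f g N → (f ⊛ g) (suc N) ≡ f 0 *ᶻ g (suc N) +ᶻ ((f ∘ suc) ⊛ g) N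
⊛-suc f g N =
  trans (cong sumℤ (map-upTo (λ i → f i *ᶻ g (suc N ∸ i)) (suc (suc N))))
    (cong (λ xs → f 0 *ᶻ g (suc N) +ᶻ sumℤ xs)
      (sym (map-upTo (λ i → f (suc i) *ᶻ g (N ∸ i)) (suc N))))

⊛-cong : ∀ {f f′ g g′} → f ≈ f′ → g ≈ g′ → f ⊛ g ≈ f′ ⊛ g′
⊛-cong {f} {f′} {g} {g′} f≈f′ g≈g′ zero =
  trans (⊛-zero f g) (trans (cong₂ _*ᶻ_ (f≈f′ 0) (g≈g′ 0)) (sym (⊛-zero f′ g′)))
⊛-cong {f} {f′} {g} {g′} f≈f′ g≈g′ (suc N) =
  trans (⊛-suc f g N)
    (trans (cong₂ _+ᶻ_ (cong₂ _*ᶻ_ (f≈f′ 0) (g≈g′ (suc N)))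
                       (⊛-cong (f≈f′ ∘ suc) g≈g′ N))
      (sym (⊛-suc f′ g′ N)))

⊛-distribʳ : ∀ f g h → (f ⊕ g) ⊛ h ≈ f ⊛ h ⊕ g ⊛ h
⊛-distribʳ f g h zero = begin
  ((f ⊕ g) ⊛ h) 0                ≡⟨ ⊛-zero (f ⊕ g) h ⟩
  (f 0 +ᶻ g 0) *ᶻ h 0            ≡⟨ ℤₚ.*-distribʳ-+ (h 0) (f 0) (g 0) ⟩
  f 0 *ᶻ h 0 +ᶻ g 0 *ᶻ h 0       ≡⟨ cong₂ _+ᶻ_ (⊛-zero f h) (⊛-zero g h) ⟨
  (f ⊛ h) 0 +ᶻ (g ⊛ h) 0         ∎
  where open ≡-Reasoning
⊛-distribʳ f g h (suc N) = begin
  ((f ⊕ g) ⊛ h) (suc N)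
    ≡⟨ ⊛-suc (f ⊕ g) h N ⟩
  (f 0 +ᶻ g 0) *ᶻ h (suc N) +ᶻ (((f ∘ suc) ⊕ (g ∘ suc)) ⊛ h) N
    ≡⟨ cong ((f 0 +ᶻ g 0) *ᶻ h (suc N) +ᶻ_) (⊛-distribʳ (f ∘ suc) (g ∘ suc) h N) ⟩
  (f 0 +ᶻ g 0) *ᶻ h (suc N) +ᶻ (((f ∘ suc) ⊛ h) N +ᶻ ((g ∘ suc) ⊛ h) N)
    ≡⟨ solve 5 (λ a b c x y → (a :+ b) :* c :+ (x :+ y) := (a :* c :+ x) :+ (b :* c :+ y)) refl
         (f 0) (g 0) (h (suc N)) (((f ∘ suc) ⊛ h) N) (((g ∘ suc) ⊛ h) N) ⟩
  (f 0 *ᶻ h (suc N) +ᶻ ((f ∘ suc) ⊛ h) N) +ᶻ (g 0 *ᶻ h (suc N) +ᶻ ((g ∘ suc) ⊛ h) N)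
    ≡⟨ cong₂ _+ᶻ_ (⊛-suc f h N) (⊛-suc g h N) ⟨
  (f ⊛ h) (suc N) +ᶻ (g ⊛ h) (suc N) ∎
  where open ≡-Reasoning; open +-*-Solver

scale : ℤ → PS → PS
scale c f N = c *ᶻ f N

⊛-scaleˡ : ∀ c f g → scale c f ⊛ g ≈ scale c (f ⊛ g)
⊛-scaleˡ c f g zero =
  trans (⊛-zero (scale c f) g) (trans (ℤₚ.*-assoc c (f 0) (g 0)) (cong (c *ᶻ_) (sym (⊛-zero f g))))
⊛-scaleˡ c f g (suc N) = begin
  (scale c f ⊛ g) (suc N)
    ≡⟨ ⊛-suc (scale c f) g N ⟩
  c *ᶻ f 0 *ᶻ g (suc N) +ᶻ (scale c (f ∘ suc) ⊛ g) N
    ≡⟨ cong (c *ᶻ f 0 *ᶻ g (suc N) +ᶻ_) (⊛-scaleˡ c (f ∘ suc) g N) ⟩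
  c *ᶻ f 0 *ᶻ g (suc N) +ᶻ c *ᶻ ((f ∘ suc) ⊛ g) N
    ≡⟨ solve 4 (λ c a b x → c :* a :* b :+ c :* x := c :* (a :* b :+ x)) refl
         c (f 0) (g (suc N)) (((f ∘ suc) ⊛ g) N) ⟩
  c *ᶻ (f 0 *ᶻ g (suc N) +ᶻ ((f ∘ suc) ⊛ g) N)
    ≡⟨ cong (c *ᶻ_) (⊛-suc f g N) ⟨
  c *ᶻ (f ⊛ g) (suc N) ∎
  where open ≡-Reasoning; open +-*-Solver

⊛-zeroˡ : ∀ g → 0ps ⊛ g ≈ 0ps
⊛-zeroˡ g zero    = ⊛-zero 0ps g
⊛-zeroˡ g (suc N) = trans (⊛-suc 0ps g N) (trans (ℤₚ.+-identityˡ _) (⊛-zeroˡ g N))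

⊛-identityˡ : ∀ g → 1ps ⊛ g ≈ g
⊛-identityˡ g zero    = trans (⊛-zero 1ps g) (ℤₚ.*-identityˡ (g 0))
⊛-identityˡ g (suc N) = begin
  (1ps ⊛ g) (suc N)                 ≡⟨ ⊛-suc 1ps g N ⟩
  1ℤ *ᶻ g (suc N) +ᶻ (0ps ⊛ g) N    ≡⟨ cong (1ℤ *ᶻ g (suc N) +ᶻ_) (⊛-zeroˡ g N) ⟩
  1ℤ *ᶻ g (suc N) +ᶻ 0ℤ             ≡⟨ ℤₚ.+-identityʳ _ ⟩
  1ℤ *ᶻ g (suc N)                   ≡⟨ ℤₚ.*-identityˡ _ ⟩
  g (suc N)                         ∎
  where open ≡-Reasoning

⊛-sucʳ : ∀ f g N → (f ⊛ g) (suc N) ≡ f (suc N) *ᶻ g 0 +ᶻ (f ⊛ (g ∘ suc)) N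
⊛-sucʳ f g zero = begin
  (f ⊛ g) 1                          ≡⟨ ⊛-suc f g 0 ⟩
  f 0 *ᶻ g 1 +ᶻ ((f ∘ suc) ⊛ g) 0    ≡⟨ cong (f 0 *ᶻ g 1 +ᶻ_) (⊛-zero (f ∘ suc) g) ⟩
  f 0 *ᶻ g 1 +ᶻ f 1 *ᶻ g 0           ≡⟨ ℤₚ.+-comm (f 0 *ᶻ g 1) (f 1 *ᶻ g 0) ⟩
  f 1 *ᶻ g 0 +ᶻ f 0 *ᶻ g 1           ≡⟨ cong (f 1 *ᶻ g 0 +ᶻ_) (⊛-zero f (g ∘ suc)) ⟨
  f 1 *ᶻ g 0 +ᶻ (f ⊛ (g ∘ suc)) 0    ∎
  where open ≡-Reasoning
⊛-sucʳ f g (suc N) = begin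
  (f ⊛ g) (suc (suc N))
    ≡⟨ ⊛-suc f g (suc N) ⟩
  f 0 *ᶻ g (suc (suc N)) +ᶻ ((f ∘ suc) ⊛ g) (suc N)
    ≡⟨ cong (f 0 *ᶻ g (suc (suc N)) +ᶻ_) (⊛-sucʳ (f ∘ suc) g N) ⟩
  f 0 *ᶻ g (suc (suc N)) +ᶻ (f (suc (suc N)) *ᶻ g 0 +ᶻ ((f ∘ suc) ⊛ (g ∘ suc)) N)
    ≡⟨ solve 3 (λ a b c → a :+ (b :+ c) := b :+ (a :+ c)) refl
         (f 0 *ᶻ g (suc (suc N))) (f (suc (suc N)) *ᶻ g 0) (((f ∘ suc) ⊛ (g ∘ suc)) N) ⟩
  f (suc (suc N)) *ᶻ g 0 +ᶻ (f 0 *ᶻ g (suc (suc N)) +ᶻ ((f ∘ suc) ⊛ (g ∘ suc)) N)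
    ≡⟨ cong (f (suc (suc N)) *ᶻ g 0 +ᶻ_) (⊛-suc f (g ∘ suc) N) ⟨
  f (suc (suc N)) *ᶻ g 0 +ᶻ (f ⊛ (g ∘ suc)) (suc N) ∎
  where open ≡-Reasoning; open +-*-Solver

⊛-comm : ∀ f g → f ⊛ g ≈ g ⊛ f
⊛-comm f g zero    = trans (⊛-zero f g) (trans (ℤₚ.*-comm (f 0) (g 0)) (sym (⊛-zero g f)))
⊛-comm f g (suc N) = begin
  (f ⊛ g) (suc N)
    ≡⟨ ⊛-suc f g N ⟩
  f 0 *ᶻ g (suc N) +ᶻ ((f ∘ suc) ⊛ g) N
    ≡⟨ cong₂ _+ᶻ_ (ℤₚ.*-comm (f 0) (g (suc N))) (⊛-comm (f ∘ suc) g N) ⟩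
  g (suc N) *ᶻ f 0 +ᶻ (g ⊛ (f ∘ suc)) N
    ≡⟨ ⊛-sucʳ g f N ⟨
  (g ⊛ f) (suc N) ∎
  where open ≡-Reasoning

⊛-assoc : ∀ f g h → (f ⊛ g) ⊛ h ≈ f ⊛ (g ⊛ h)
⊛-assoc f g h zero = begin
  ((f ⊛ g) ⊛ h) 0        ≡⟨ ⊛-zero (f ⊛ g) h ⟩
  (f ⊛ g) 0 *ᶻ h 0       ≡⟨ cong (_*ᶻ h 0) (⊛-zero f g) ⟩
  f 0 *ᶻ g 0 *ᶻ h 0      ≡⟨ ℤₚ.*-assoc (f 0) (g 0) (h 0) ⟩
  f 0 *ᶻ (g 0 *ᶻ h 0)    ≡⟨ cong (f 0 *ᶻ_) (⊛-zero g h) ⟨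
  f 0 *ᶻ (g ⊛ h) 0       ≡⟨ ⊛-zero f (g ⊛ h) ⟨
  (f ⊛ (g ⊛ h)) 0        ∎
  where open ≡-Reasoning
⊛-assoc f g h (suc N) = begin
  ((f ⊛ g) ⊛ h) (suc N)
    ≡⟨ ⊛-suc (f ⊛ g) h N ⟩
  (f ⊛ g) 0 *ᶻ h (suc N) +ᶻ (((f ⊛ g) ∘ suc) ⊛ h) N
    ≡⟨ cong₂ _+ᶻ_ (cong (_*ᶻ h (suc N)) (⊛-zero f g)) (⊛-cong {g = h} (⊛-suc f g) (λ _ → refl) N) ⟩
  f 0 *ᶻ g 0 *ᶻ h (suc N) +ᶻ ((scale (f 0) (g ∘ suc) ⊕ (f ∘ suc) ⊛ g) ⊛ h) N
    ≡⟨ cong (f 0 *ᶻ g 0 *ᶻ h (suc N) +ᶻ_)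
         (trans (⊛-distribʳ (scale (f 0) (g ∘ suc)) ((f ∘ suc) ⊛ g) h N)
                (cong₂ _+ᶻ_ (⊛-scaleˡ (f 0) (g ∘ suc) h N) (⊛-assoc (f ∘ suc) g h N))) ⟩
  f 0 *ᶻ g 0 *ᶻ h (suc N) +ᶻ (f 0 *ᶻ ((g ∘ suc) ⊛ h) N +ᶻ ((f ∘ suc) ⊛ (g ⊛ h)) N)
    ≡⟨ solve 5 (λ a b c x y → a :* b :* c :+ (a :* x :+ y) := a :* (b :* c :+ x) :+ y) refl
         (f 0) (g 0) (h (suc N)) (((g ∘ suc) ⊛ h) N) (((f ∘ suc) ⊛ (g ⊛ h)) N) ⟩
  f 0 *ᶻ (g 0 *ᶻ h (suc N) +ᶻ ((g ∘ suc) ⊛ h) N) +ᶻ ((f ∘ suc) ⊛ (g ⊛ h)) N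
    ≡⟨ cong (λ z → f 0 *ᶻ z +ᶻ ((f ∘ suc) ⊛ (g ⊛ h)) N) (⊛-suc g h N) ⟨
  f 0 *ᶻ (g ⊛ h) (suc N) +ᶻ ((f ∘ suc) ⊛ (g ⊛ h)) N
    ≡⟨ ⊛-suc f (g ⊛ h) N ⟨
  (f ⊛ (g ⊛ h)) (suc N) ∎
  where open ≡-Reasoning; open +-*-Solver

PS-commutativeRing : CommutativeRing _ _
PS-commutativeRing = record
  { Carrier = PS
  ; _≈_ = _≈_
  ; _+_ = _⊕_
  ; _*_ = _⊛_
  ; -_ = λ f → -ᶻ_ ∘ f
  ; 0# = 0ps
  ; 1# = 1ps
  ; isCommutativeRing = record
    { isRing = record
      { +-isAbelianGroup = Pointwise.isAbelianGroup ℕ ℤₚ.+-0-isAbelianGroup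
      ; *-cong = ⊛-cong
      ; *-assoc = ⊛-assoc
      ; *-identity = ⊛-identityˡ , λ f N → trans (⊛-comm f 1ps N) (⊛-identityˡ f N)
      ; distrib = ⊛-distribˡ , λ h f g → ⊛-distribʳ f g h
      }
    ; *-comm = ⊛-comm
    }
  }
  where
  ⊛-distribˡ : ∀ f g h → f ⊛ (g ⊕ h) ≈ f ⊛ g ⊕ f ⊛ h
  ⊛-distribˡ f g h N = trans (⊛-comm f (g ⊕ h) N)
    (trans (⊛-distribʳ g h f N) (cong₂ _+ᶻ_ (⊛-comm g f N) (⊛-comm h f N)))

constant : ℤ → PS
constant c zero    = c
constant c (suc _) = 0ℤ

constant-morphism : CommutativeRing.rawRing ℤₚ.+-*-commutativeRing
                    -Raw-AlmostCommutative⟶ fromCommutativeRing PS-commutativeRing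
constant-morphism = record
  { ⟦_⟧ = constant
  ; +-homo = λ { _ _ zero → refl ; _ _ (suc _) → refl }
  ; *-homo = λ { x y zero → sym (⊛-zero (constant x) (constant y))
               ; x y (suc N) → sym (trans (⊛-suc (constant x) (constant y) N)
                                     (cong₂ _+ᶻ_ (ℤₚ.*-zeroʳ x) (⊛-zeroˡ (constant y) N))) }
  ; -‿homo = λ { _ zero → refl ; _ (suc _) → refl }
  ; 0-homo = λ { zero → refl ; (suc _) → refl }
  ; 1-homo = λ { zero → refl ; (suc _) → refl }
  }

constant-≟ : ∀ x y → Maybe (constant x ≈ constant y)
constant-≟ x y with x ℤₚ.≟ y
... | yes refl = just (λ _ → refl)
... | no _     = nothing

module PS-Solver = Algebra.Solver.Ring _ _ constant-morphism constant-≟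

open CommutativeRing PS-commutativeRing using (setoid; +-cong)
  renaming (refl to ≈-refl; sym to ≈-sym; trans to ≈-trans; +-assoc to ⊕-assoc; *-identityʳ to ⊛-identityʳ)

module PS-Reasoning = Relation.Binary.Reasoning.Setoid setoid

qpow-zero : qpow 0 ≈ 1ps
qpow-zero zero    = refl
qpow-zero (suc _) = refl

qpow-suc-⊛ : ∀ e g N → (qpow (suc e) ⊛ g) (suc N) ≡ (qpow e ⊛ g) N
qpow-suc-⊛ e g N = trans (⊛-suc (qpow (suc e)) g N) (ℤₚ.+-identityˡ _)

qpow-⊛-below : ∀ e g N → N < e → (qpow e ⊛ g) N ≡ 0ℤ
qpow-⊛-below (suc e) g zero    _         = ⊛-zero (qpow (suc e)) g
qpow-⊛-below (suc e) g (suc N) (s≤s N<e) = trans (qpow-suc-⊛ e g N) (qpow-⊛-below e g N N<e)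

qpow-+ : ∀ m n → qpow (m + n) ≈ qpow m ⊛ qpow n
qpow-+ zero    n N       =
  sym (trans (⊛-cong {g = qpow n} qpow-zero (λ _ → refl) N) (⊛-identityˡ (qpow n) N))
qpow-+ (suc m) n zero    = sym (⊛-zero (qpow (suc m)) (qpow n))
qpow-+ (suc m) n (suc N) = trans (qpow-+ m n N) (sym (qpow-suc-⊛ m (qpow n) N))

qpow-split : ∀ {e} m n → e ≡ m + n → qpow e ≈ qpow m ⊛ qpow n
qpow-split m n refl = qpow-+ m n

zipWith-applyUpTo : ∀ {A B C : Set} (h : A → B → C) (a : ℕ → A) (b : ℕ → B) n →
                    zipWith h (applyUpTo a n) (applyUpTo b n) ≡ applyUpTo (λ i → h (a i) (b i)) n
zipWith-applyUpTo h a b zero    = refl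
zipWith-applyUpTo h a b (suc n) = cong (h (a 0) (b 0) ∷_) (zipWith-applyUpTo h (a ∘ suc) (b ∘ suc) n)

invRev-applyUpTo : ∀ f N → invRev f N ≡ applyUpTo (λ i → inv f (N ∸ i)) (suc N)
invRev-applyUpTo f zero    = refl
invRev-applyUpTo f (suc N) = cong (inv f (suc N) ∷_) (invRev-applyUpTo f N)

inv-suc : ∀ f N → inv f (suc N) ≡ -ᶻ ((f ∘ suc) ⊛ inv f) N
inv-suc f N = cong (λ xs → -ᶻ sumℤ xs)
  (trans (cong₂ (zipWith _*ᶻ_) (map-upTo (f ∘ suc) (suc N)) (invRev-applyUpTo f N))
    (trans (zipWith-applyUpTo _*ᶻ_ (f ∘ suc) (λ i → inv f (N ∸ i)) (suc N))
      (sym (map-upTo (λ i → f (suc i) *ᶻ inv f (N ∸ i)) (suc N)))))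

⊛-inverseʳ : ∀ f → f 0 ≡ 1ℤ → f ⊛ inv f ≈ 1ps
⊛-inverseʳ f f₀≡1 zero    = trans (⊛-zero f (inv f)) (cong (_*ᶻ 1ℤ) f₀≡1)
⊛-inverseʳ f f₀≡1 (suc N) =
  trans (⊛-suc f (inv f) N)
    (trans (cong (_+ᶻ ((f ∘ suc) ⊛ inv f) N)
                 (trans (cong (_*ᶻ inv f (suc N)) f₀≡1) (trans (ℤₚ.*-identityˡ _) (inv-suc f N))))
      (ℤₚ.+-inverseˡ (((f ∘ suc) ⊛ inv f) N)))

inv-unique : ∀ f g → f 0 ≡ 1ℤ → f ⊛ g ≈ 1ps → g ≈ inv f
inv-unique f g f₀≡1 fg≈1 = begin
  g                ≈⟨ ≈-sym (⊛-identityʳ g) ⟩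
  g ⊛ 1ps          ≈⟨ ⊛-cong (≈-refl {g}) (≈-sym (⊛-inverseʳ f f₀≡1)) ⟩
  g ⊛ (f ⊛ inv f)  ≈⟨ ≈-sym (⊛-assoc g f (inv f)) ⟩
  (g ⊛ f) ⊛ inv f  ≈⟨ ⊛-cong (≈-trans (⊛-comm g f) fg≈1) (≈-refl {inv f}) ⟩
  1ps ⊛ inv f      ≈⟨ ⊛-identityˡ (inv f) ⟩
  inv f            ∎
  where open PS-Reasoning

inv-⊛ : ∀ f g → f 0 ≡ 1ℤ → g 0 ≡ 1ℤ → inv (f ⊛ g) ≈ inv f ⊛ inv g
inv-⊛ f g f₀≡1 g₀≡1 = ≈-sym (inv-unique (f ⊛ g) (inv f ⊛ inv g) fg₀≡1 (begin
  (f ⊛ g) ⊛ (inv f ⊛ inv g)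
    ≈⟨ solve 4 (λ f g f′ g′ → (f :* g) :* (f′ :* g′) := (f :* f′) :* (g :* g′)) ≈-refl f g (inv f) (inv g) ⟩
  (f ⊛ inv f) ⊛ (g ⊛ inv g)
    ≈⟨ ⊛-cong (⊛-inverseʳ f f₀≡1) (⊛-inverseʳ g g₀≡1) ⟩
  1ps ⊛ 1ps
    ≈⟨ ⊛-identityˡ 1ps ⟩
  1ps ∎))
  where
  open PS-Reasoning
  open PS-Solver
  fg₀≡1 : (f ⊛ g) 0 ≡ 1ℤ
  fg₀≡1 = trans (⊛-zero f g) (cong₂ _*ᶻ_ f₀≡1 g₀≡1)

inv-local : ∀ f g N → (∀ i → i ≤ N → f i ≡ g i) → inv f N ≡ inv g N
inv-local f g N agree = cong (fromMaybe 0ℤ ∘ head) (invRev-local N agree)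
  where
  invRev-local : ∀ N → (∀ i → i ≤ N → f i ≡ g i) → invRev f N ≡ invRev g N
  invRev-local zero    _     = refl
  invRev-local (suc N) agree = cong₂ (λ xs cs → -ᶻ sumℤ (zipWith _*ᶻ_ xs cs) ∷ cs)
    (map-cong-local (applyUpTo⁺₁ (λ i → i) (suc N) (λ i<1+N → agree _ i<1+N)))
    (invRev-local N (λ i i≤N → agree i (ℕₚ.m≤n⇒m≤1+n i≤N)))

poch-zero : ∀ k → poch k 0 ≡ 1ℤ
poch-zero zero    = refl
poch-zero (suc k) = trans (⊛-zero (poch k) (1ps ⊖ qpow (suc k))) (cong (_*ᶻ 1ℤ) (poch-zero k))

poch-suc : ∀ k → poch (suc k) ≈ poch k ⊖ poch k ⊛ qpow (suc k)
poch-suc k = begin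
  poch k ⊛ (1ps ⊖ qpow (suc k))
    ≈⟨ solve 3 (λ p o u → p :* (o :- u) := p :* o :- p :* u) ≈-refl (poch k) 1ps (qpow (suc k)) ⟩
  poch k ⊛ 1ps ⊖ poch k ⊛ qpow (suc k)
    ≈⟨ +-cong (⊛-identityʳ (poch k)) (λ _ → refl) ⟩
  poch k ⊖ poch k ⊛ qpow (suc k) ∎
  where open PS-Reasoning; open PS-Solver

poch-stable : ∀ k i → i ≤ k → poch (suc k) i ≡ poch k i
poch-stable k i i≤k = begin
  poch (suc k) i
    ≡⟨ poch-suc k i ⟩
  poch k i -ᶻ (poch k ⊛ qpow (suc k)) i
    ≡⟨ cong (λ x → poch k i -ᶻ x) (⊛-comm (poch k) (qpow (suc k)) i) ⟩
  poch k i -ᶻ (qpow (suc k) ⊛ poch k) i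
    ≡⟨ cong (λ x → poch k i -ᶻ x) (qpow-⊛-below (suc k) (poch k) i (s≤s i≤k)) ⟩
  poch k i -ᶻ 0ℤ
    ≡⟨ ℤₚ.+-identityʳ (poch k i) ⟩
  poch k i ∎
  where open ≡-Reasoning

poch-pochInf : ∀ k i → i ≤ k → poch k i ≡ pochInf i
poch-pochInf zero    zero z≤n   = refl
poch-pochInf (suc k) i    i≤1+k with ℕₚ.m≤n⇒m<n∨m≡n i≤1+k
... | inj₁ i<1+k = trans (poch-stable k i (ℕₚ.≤-pred i<1+k)) (poch-pochInf k i (ℕₚ.≤-pred i<1+k))
... | inj₂ refl  = refl

poch⁻¹ : ℕ → PS
poch⁻¹ k = inv (poch k)

poch⁻¹-zero : poch⁻¹ 0 ≈ 1ps
poch⁻¹-zero = ≈-sym (inv-unique 1ps 1ps refl (⊛-identityˡ 1ps))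

poch⁻¹-step : ∀ k → poch⁻¹ k ≈ poch⁻¹ (suc k) ⊖ qpow (suc k) ⊛ poch⁻¹ (suc k)
poch⁻¹-step k = ≈-sym (inv-unique (poch k) _ (poch-zero k) (begin
  poch k ⊛ (poch⁻¹ (suc k) ⊖ qpow (suc k) ⊛ poch⁻¹ (suc k))
    ≈⟨ solve 3 (λ p u i → p :* (i :- u :* i) := (p :- p :* u) :* i) ≈-refl
         (poch k) (qpow (suc k)) (poch⁻¹ (suc k)) ⟩
  (poch k ⊖ poch k ⊛ qpow (suc k)) ⊛ poch⁻¹ (suc k)
    ≈⟨ ⊛-cong (≈-sym (poch-suc k)) (≈-refl {poch⁻¹ (suc k)}) ⟩
  poch (suc k) ⊛ poch⁻¹ (suc k)
    ≈⟨ ⊛-inverseʳ (poch (suc k)) (poch-zero (suc k)) ⟩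
  1ps ∎))
  where open PS-Reasoning; open PS-Solver

poch⁻¹-pochInf : ∀ k N → N ≤ k → poch⁻¹ k N ≡ inv pochInf N
poch⁻¹-pochInf k N N≤k =
  inv-local (poch k) pochInf N (λ i i≤N → poch-pochInf k i (ℕₚ.≤-trans i≤N N≤k))

sumPS-coeff-cong : ∀ n {F G : ℕ → PS} N → (∀ i → F i N ≡ G i N) → sumPS n F N ≡ sumPS n G N
sumPS-coeff-cong zero    N F≡G = refl
sumPS-coeff-cong (suc n) N F≡G = cong₂ _+ᶻ_ (sumPS-coeff-cong n N F≡G) (F≡G n)

sumPS-cong : ∀ n {F G : ℕ → PS} → (∀ i → F i ≈ G i) → sumPS n F ≈ sumPS n G
sumPS-cong n F≈G N = sumPS-coeff-cong n N (λ i → F≈G i N)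

sumPS-⊕ : ∀ n (F G : ℕ → PS) → sumPS n F ⊕ sumPS n G ≈ sumPS n (λ k → F k ⊕ G k)
sumPS-⊕ zero    F G N = ℤₚ.+-identityʳ 0ℤ
sumPS-⊕ (suc n) F G   = ≈-trans
  (solve 4 (λ a b c d → (a :+ b) :+ (c :+ d) := (a :+ c) :+ (b :+ d)) ≈-refl
           (sumPS n F) (F n) (sumPS n G) (G n))
  (+-cong (sumPS-⊕ n F G) (≈-refl {F n ⊕ G n}))
  where open PS-Solver

sumPS-zero : ∀ n → sumPS n (λ _ → 0ps) ≈ 0ps
sumPS-zero zero    N = refl
sumPS-zero (suc n) N = trans (ℤₚ.+-identityʳ _) (sumPS-zero n N)

sumPS-comm : ∀ l K (H : ℕ → ℕ → PS) →
             sumPS l (λ i → sumPS K (H i)) ≈ sumPS K (λ k → sumPS l (λ i → H i k))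
sumPS-comm zero    K H = ≈-sym (sumPS-zero K)
sumPS-comm (suc l) K H = ≈-trans (+-cong (sumPS-comm l K H) (≈-refl {sumPS K (H l)}))
                                 (sumPS-⊕ K (λ k → sumPS l (λ i → H i k)) (H l))

sumPS-+ : ∀ n m (F : ℕ → PS) → sumPS (n + m) F ≈ sumPS m F ⊕ sumPS n (λ i → F (i + m))
sumPS-+ zero    m F N = sym (ℤₚ.+-identityʳ (sumPS m F N))
sumPS-+ (suc n) m F   = ≈-trans (+-cong (sumPS-+ n m F) (≈-refl {F (n + m)}))
                                (⊕-assoc (sumPS m F) (sumPS n (λ i → F (i + m))) (F (n + m)))

sumPS-telescope : ∀ (f g : ℕ → PS) → (∀ k → f (suc k) ≈ f k ⊕ g k) →
                  ∀ K → f K ≈ f 0 ⊕ sumPS K g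
sumPS-telescope f g step zero    N = sym (ℤₚ.+-identityʳ (f 0 N))
sumPS-telescope f g step (suc K)   = begin
  f (suc K)                ≈⟨ step K ⟩
  f K ⊕ g K                ≈⟨ +-cong (sumPS-telescope f g step K) (≈-refl {g K}) ⟩
  f 0 ⊕ sumPS K g ⊕ g K    ≈⟨ ⊕-assoc (f 0) (sumPS K g) (g K) ⟩
  f 0 ⊕ sumPS (suc K) g    ∎
  where open PS-Reasoning

sumPS-coeff-head : ∀ n (F : ℕ → PS) N → (∀ j → F (suc j) N ≡ 0ℤ) → sumPS (suc n) F N ≡ F 0 N
sumPS-coeff-head zero    F N _      = ℤₚ.+-identityˡ (F 0 N)
sumPS-coeff-head (suc n) F N tail≡0 =
  trans (cong₂ _+ᶻ_ (sumPS-coeff-head n F N tail≡0) (tail≡0 n)) (ℤₚ.+-identityʳ (F 0 N))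

term : ℕ → ℕ → ℕ → PS
term e a b = qpow e ⊘ (poch a ⊛ poch b)

diagonalTerm rowTerm : ℕ → ℕ → PS
diagonalTerm a b = term (a * b) a b
rowTerm      a b = term (suc a * b) a b

term≈ : ∀ e a b → term e a b ≈ qpow e ⊛ (poch⁻¹ a ⊛ poch⁻¹ b)
term≈ e a b = ⊛-cong (≈-refl {qpow e}) (inv-⊛ (poch a) (poch b) (poch-zero a) (poch-zero b))

term-zero : ∀ a b → term 0 a b ≈ poch⁻¹ a ⊛ poch⁻¹ b
term-zero a b = ≈-trans (term≈ 0 a b)
  (≈-trans (⊛-cong qpow-zero (≈-refl {poch⁻¹ a ⊛ poch⁻¹ b}))
           (⊛-identityˡ (poch⁻¹ a ⊛ poch⁻¹ b)))

term-below : ∀ e a b N → N < e → term e a b N ≡ 0ℤ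
term-below e a b = qpow-⊛-below e (inv (poch a ⊛ poch b))

term-edge : ∀ b → diagonalTerm 0 b ⊕ rowTerm 0 (suc b) ≈ diagonalTerm 0 (suc b)
term-edge b = begin
  term 0 0 b ⊕ term (1 * suc b) 0 (suc b)
    ≈⟨ +-cong (≈-trans (term-zero 0 b) (⊛-cong (≈-refl {I₀}) (poch⁻¹-step b)))
              (≈-trans (term≈ (1 * suc b) 0 (suc b))
                       (⊛-cong (cong-app (cong qpow (ℕₚ.*-identityˡ (suc b)))) (≈-refl {I₀ ⊛ β}))) ⟩
  I₀ ⊛ (β ⊖ v ⊛ β) ⊕ v ⊛ (I₀ ⊛ β)
    ≈⟨ solve 3 (λ I₀ β v → I₀ :* (β :- v :* β) :+ v :* (I₀ :* β) := I₀ :* β) ≈-refl I₀ β v ⟩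
  I₀ ⊛ β
    ≈⟨ term-zero 0 (suc b) ⟨
  term 0 0 (suc b) ∎
  where
  open PS-Reasoning
  open PS-Solver
  I₀ β v : PS
  I₀ = poch⁻¹ 0
  β  = poch⁻¹ (suc b)
  v  = qpow (suc b)

-- After cancelling q^{(a+1)b} / ((q)_{a+1} (q)_{b+1}) this is
-- (1 - q^{b+1}) + q^{a+1} q^{b+1} = (1 - q^{a+1}) (1 - q^{b+1}) + q^{a+1}.
term-corner : ∀ a b → diagonalTerm (suc a) b ⊕ rowTerm (suc a) (suc b)
                      ≈ rowTerm a b ⊕ diagonalTerm (suc a) (suc b)
term-corner a b = begin
  diagonalTerm (suc a) b ⊕ rowTerm (suc a) (suc b)
    ≈⟨ +-cong diagonal-b row-1+b ⟩
  X ⊛ (α ⊛ (β ⊖ v ⊛ β)) ⊕ X ⊛ u ⊛ v ⊛ (α ⊛ β)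
    ≈⟨ solve 5 (λ X u v α β → X :* (α :* (β :- v :* β)) :+ X :* u :* v :* (α :* β)
                           := X :* ((α :- u :* α) :* (β :- v :* β)) :+ X :* u :* (α :* β))
         ≈-refl X u v α β ⟩
  X ⊛ ((α ⊖ u ⊛ α) ⊛ (β ⊖ v ⊛ β)) ⊕ X ⊛ u ⊛ (α ⊛ β)
    ≈⟨ +-cong row-b diagonal-1+b ⟨
  rowTerm a b ⊕ diagonalTerm (suc a) (suc b) ∎
  where
  open PS-Reasoning
  open PS-Solver
  X u v α β : PS
  X = qpow (suc a * b)
  u = qpow (suc a)
  v = qpow (suc b)
  α = poch⁻¹ (suc a)
  β = poch⁻¹ (suc b)
  exponent-diagonal : ∀ a b → suc a * suc b ≡ suc a * b + suc a
  exponent-diagonal = solve-∀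
  exponent-row : ∀ a b → suc (suc a) * suc b ≡ suc a * b + suc a + suc b
  exponent-row = solve-∀
  qpow-diagonal : qpow (suc a * suc b) ≈ X ⊛ u
  qpow-diagonal = qpow-split (suc a * b) (suc a) (exponent-diagonal a b)
  qpow-row : qpow (suc (suc a) * suc b) ≈ X ⊛ u ⊛ v
  qpow-row = ≈-trans (qpow-split (suc a * b + suc a) (suc b) (exponent-row a b))
                     (⊛-cong (qpow-+ (suc a * b) (suc a)) (≈-refl {v}))
  diagonal-b : diagonalTerm (suc a) b ≈ X ⊛ (α ⊛ (β ⊖ v ⊛ β))
  diagonal-b = ≈-trans (term≈ (suc a * b) (suc a) b)
                       (⊛-cong (≈-refl {X}) (⊛-cong (≈-refl {α}) (poch⁻¹-step b)))
  row-b : rowTerm a b ≈ X ⊛ ((α ⊖ u ⊛ α) ⊛ (β ⊖ v ⊛ β))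
  row-b = ≈-trans (term≈ (suc a * b) a b)
                  (⊛-cong (≈-refl {X}) (⊛-cong (poch⁻¹-step a) (poch⁻¹-step b)))
  diagonal-1+b : diagonalTerm (suc a) (suc b) ≈ X ⊛ u ⊛ (α ⊛ β)
  diagonal-1+b = ≈-trans (term≈ (suc a * suc b) (suc a) (suc b))
                         (⊛-cong qpow-diagonal (≈-refl {α ⊛ β}))
  row-1+b : rowTerm (suc a) (suc b) ≈ X ⊛ u ⊛ v ⊛ (α ⊛ β)
  row-1+b = ≈-trans (term≈ (suc (suc a) * suc b) (suc a) (suc b))
                    (⊛-cong qpow-row (≈-refl {α ⊛ β}))

case-χ-suc : ∀ a b → case-χ (suc a) b ≡ sumPS b (rowTerm a)
case-χ-suc a zero    = refl
case-χ-suc a (suc b) = refl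

case-χ-zeroʳ : ∀ a → case-χ a 0 ≡ 0ps
case-χ-zeroʳ zero    = refl
case-χ-zeroʳ (suc a) = refl

χ-diagonal-step : ∀ a b → case-χ a b ⊕ diagonalTerm a b ⊕ rowTerm a (suc b)
                          ≈ case-χ a (suc b) ⊕ diagonalTerm a (suc b)
χ-diagonal-step zero    b =
  ≈-trans (⊕-assoc 0ps (diagonalTerm 0 b) (rowTerm 0 (suc b))) (+-cong (≈-refl {0ps}) (term-edge b))
χ-diagonal-step (suc a) b = begin
  χ ⊕ diagonalTerm (suc a) b ⊕ rowTerm (suc a) (suc b)
    ≈⟨ ⊕-assoc χ (diagonalTerm (suc a) b) (rowTerm (suc a) (suc b)) ⟩
  χ ⊕ (diagonalTerm (suc a) b ⊕ rowTerm (suc a) (suc b))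
    ≈⟨ +-cong (≈-refl {χ}) (term-corner a b) ⟩
  χ ⊕ (rowTerm a b ⊕ diagonalTerm (suc a) (suc b))
    ≈⟨ ⊕-assoc χ (rowTerm a b) (diagonalTerm (suc a) (suc b)) ⟨
  χ ⊕ rowTerm a b ⊕ diagonalTerm (suc a) (suc b)
    ≈⟨ cong-app (cong (λ s → s ⊕ rowTerm a b ⊕ diagonalTerm (suc a) (suc b)) (case-χ-suc a b)) ⟩
  case-χ (suc a) (suc b) ⊕ diagonalTerm (suc a) (suc b) ∎
  where
  open PS-Reasoning
  χ : PS
  χ = case-χ (suc a) b

χ-diagonal : ∀ a b → case-χ (suc a) (suc b) ≈ case-χ a b ⊕ diagonalTerm a b
χ-diagonal a zero    = cong-app (cong₂ _⊕_ (sym (case-χ-zeroʳ a))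
  (cong (λ e → term e a 0) (trans (ℕₚ.*-zeroʳ (suc a)) (sym (ℕₚ.*-zeroʳ a)))))
χ-diagonal a (suc b) =
  ≈-trans (+-cong (χ-diagonal a b) (≈-refl {rowTerm a (suc b)})) (χ-diagonal-step a b)

χ-diagonal-rows : ∀ a b l →
  case-χ (suc a) (l + suc b)
    ≈ case-χ a b ⊕ (diagonalTerm a b ⊕ sumPS l (λ i → term ((a + 1) * (b + suc i)) a (b + suc i)))
χ-diagonal-rows a b l = begin
  case-χ (suc a) (l + suc b)
    ≈⟨ cong-app (case-χ-suc a (l + suc b)) ⟩
  sumPS (l + suc b) (rowTerm a)
    ≈⟨ sumPS-+ l (suc b) (rowTerm a) ⟩
  case-χ (suc a) (suc b) ⊕ sumPS l (λ i → rowTerm a (i + suc b))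
    ≈⟨ +-cong (χ-diagonal a b) (sumPS-cong l (λ i → cong-app (rowTerm-reindex i))) ⟩
  case-χ a b ⊕ diagonalTerm a b ⊕ rows
    ≈⟨ ⊕-assoc (case-χ a b) (diagonalTerm a b) rows ⟩
  case-χ a b ⊕ (diagonalTerm a b ⊕ rows) ∎
  where
  open PS-Reasoning
  rows : PS
  rows = sumPS l (λ i → term ((a + 1) * (b + suc i)) a (b + suc i))
  rowTerm-reindex : ∀ i → rowTerm a (i + suc b) ≡ term ((a + 1) * (b + suc i)) a (b + suc i)
  rowTerm-reindex i = cong₂ (λ c d → term (c * d) a d)
    (ℕₚ.+-comm 1 a) (trans (ℕₚ.+-comm i (suc b)) (sym (ℕₚ.+-suc b i)))

χ-coeff : ∀ a b N → N ≤ a → case-χ (suc a) (suc b) N ≡ inv pochInf N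
χ-coeff a b N N≤a = begin
  sumPS (suc b) (rowTerm a) N
    ≡⟨ sumPS-coeff-head b (rowTerm a) N
         (λ j → term-below (suc a * suc j) a (suc j) N
                  (ℕₚ.<-≤-trans (s≤s N≤a) (ℕₚ.m≤m*n (suc a) (suc j)))) ⟩
  term (suc a * 0) a 0 N
    ≡⟨ cong (λ e → term e a 0 N) (ℕₚ.*-zeroʳ (suc a)) ⟩
  term 0 a 0 N
    ≡⟨ term-zero a 0 N ⟩
  (poch⁻¹ a ⊛ poch⁻¹ 0) N
    ≡⟨ ⊛-cong (≈-refl {poch⁻¹ a}) poch⁻¹-zero N ⟩
  (poch⁻¹ a ⊛ 1ps) N
    ≡⟨ ⊛-identityʳ (poch⁻¹ a) N ⟩
  poch⁻¹ a N
    ≡⟨ poch⁻¹-pochInf a N N≤a ⟩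
  inv pochInf N ∎
  where open ≡-Reasoning

sumPS-merge : ∀ K l (F : ℕ → PS) (H : ℕ → ℕ → PS) →
              sumPS K F ⊕ sumPS l (λ i → sumPS K (H i)) ≈ sumPS K (λ k → F k ⊕ sumPS l (λ i → H i k))
sumPS-merge K l F H = ≈-trans (+-cong (≈-refl {sumPS K F}) (sumPS-comm l K H))
                              (sumPS-⊕ K F (λ k → sumPS l (λ i → H i k)))

mainTheorem5 : (l m n : ℕ) →
    inv pochInf
      ≈ (case-χ n m)
        ⊕ sumInf (λ k → qpow ((k + n) * ((suc l) * k + m)) ⊘ (poch (k + n) ⊛ poch ((suc l) * k + m)))
        ⊕ sumPS1 l (λ i → sumInf (λ k → qpow ((k + n + 1) * ((suc l) * k + m + i)) ⊘ (poch (k + n) ⊛ poch ((suc l) * k + m + i))))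
mainTheorem5 l m n N = begin
  inv pochInf N
    ≡⟨ χ-coeff (N + n) (N + l * suc N + m) N (ℕₚ.m≤m+n N n) ⟨
  χ-path (suc N) N
    ≡⟨ sumPS-telescope χ-path summand step (suc N) N ⟩
  (χ-path 0 ⊕ sumPS (suc N) summand) N
    ≡⟨ cong (λ b → case-χ n b N +ᶻ sumPS (suc N) summand N) (cong (_+ m) (ℕₚ.*-zeroʳ (suc l))) ⟩
  (case-χ n m ⊕ sumPS (suc N) summand) N
    ≡⟨ cong (case-χ n m N +ᶻ_) (sumPS-merge (suc N) l diagonal (row ∘ suc) N) ⟨
  (case-χ n m ⊕ (sumPS (suc N) diagonal ⊕ rows)) N
    ≡⟨ ⊕-assoc (case-χ n m) (sumPS (suc N) diagonal) rows N ⟨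
  (case-χ n m ⊕ sumPS (suc N) diagonal ⊕ rows) N
    ≡⟨ cong (case-χ n m N +ᶻ sumPS (suc N) diagonal N +ᶻ_) (sumPS-coeff-cong l N (λ i → refl)) ⟩
  (case-χ n m ⊕ sumInf diagonal ⊕ sumPS1 l (λ i → sumInf (row i))) N ∎
  where
  open ≡-Reasoning
  B : ℕ → ℕ
  B k = suc l * k + m
  χ-path diagonal : ℕ → PS
  χ-path k   = case-χ (k + n) (B k)
  diagonal k = diagonalTerm (k + n) (B k)
  row : ℕ → ℕ → PS
  row i k = term ((k + n + 1) * (B k + i)) (k + n) (B k + i)
  summand : ℕ → PS
  summand k = diagonal k ⊕ sumPS l (λ i → row (suc i) k)
  rows : PS
  rows = sumPS l (λ i → sumPS (suc N) (row (suc i)))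
  B-suc : ∀ l m k → suc l * suc k + m ≡ l + suc (suc l * k + m)
  B-suc = solve-∀
  step : ∀ k → χ-path (suc k) ≈ χ-path k ⊕ summand k
  step k = ≈-trans (cong-app (cong (case-χ (suc (k + n))) (B-suc l m k))) (χ-diagonal-rows (k + n) (B k) l)
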